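{- Let $G(V, E)$ be a simple connected graph with diameter $D$, $|V| = n$, and $\mathrm{edim}(G) = k$. Then: $$|E| \leq \binom{k}{2} + kD^{k-1} + D^k .$$
   Context: For an edge $e=xy$ and a vertex $v$, $d(e,v)=\min\{d(x,v),d(y,v)\}$. A set $S\subseteq V$ is an edge metric generator if for any two distinct edges $e_1,e_2$ some $s\in S$ has $d(e_1,s)\neq d(e_2,s)$; $\mathrm{edim}(G)$ is the minimum size of an edge metric generator. The diameter is $\max\{d(u,v)\mid u,v\in V\}$. -}

module Defs where

open import Data.Nat using (ℕ; zero; suc; _≤_; _⊓_)
open import Data.Fin using (Fin; _<_; _<?_)
open import Data.Fin.Subset using (Subset; _∈_; ∣_∣)
open import Data.Bool using (Bool; true; false; T)
open import Data.List using (List; length; filter; cartesianProduct; allFin)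
open import Data.Product using (Σ; ∃; ∃-syntax; _×_; _,_)
open import Relation.Binary.PropositionalEquality using (_≡_; _≢_)
open import Relation.Nullary using (Dec; yes; no; _×-dec_)
open import Data.Bool using (T?)

record Graph (n : ℕ) : Set where
  field
    adj    : Fin n → Fin n → Bool
    sym    : ∀ x y → adj x y ≡ adj y x
    irrefl : ∀ x → adj x x ≡ false
open Graph public

module _ {n : ℕ} (G : Graph n) where

  data Walk : Fin n → Fin n → ℕ → Set where
    here : ∀ {x} → Walk x x 0
    step : ∀ {x y z ℓ} → T (adj G x y) → Walk y z ℓ → Walk x z (suc ℓ)

  Connected : Set
  Connected = ∀ x y → ∃[ ℓ ] Walk x y ℓ

  Dist : Fin n → Fin n → ℕ → Set
  Dist x y m = Walk x y m × (∀ ℓ → Walk x y ℓ → m ≤ ℓ)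

  IsDiameter : ℕ → Set
  IsDiameter D = (∃[ u ] ∃[ v ] Dist u v D) × (∀ u v m → Dist u v m → m ≤ D)

  -- edges: unordered pairs {x,y}, represented as x < y with x adjacent to y
  Edge : Set
  Edge = Σ (Fin n × Fin n) λ { (x , y) → x < y × T (adj G x y) }

  EDist : Fin n × Fin n → Fin n → ℕ → Set
  EDist (x , y) v m = ∃[ a ] ∃[ b ] (Dist x v a × Dist y v b × m ≡ a ⊓ b)

  IsEdgeMetricGenerator : Subset n → Set
  IsEdgeMetricGenerator S =
    ∀ (e₁ e₂ : Edge) → Σ.proj₁ e₁ ≢ Σ.proj₁ e₂ →
      ∃[ s ] (s ∈ S × ∃[ a ] ∃[ b ] (EDist (Σ.proj₁ e₁) s a × EDist (Σ.proj₁ e₂) s b × a ≢ b))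

  IsEdim : ℕ → Set
  IsEdim k = (∃[ S ] (IsEdgeMetricGenerator S × ∣ S ∣ ≡ k))
           × (∀ S → IsEdgeMetricGenerator S → k ≤ ∣ S ∣)

  numEdges : ℕ
  numEdges = length (filter (λ { (x , y) → (x <? y) ×-dec T? (adj G x y) })
                            (cartesianProduct (allFin n) (allFin n)))

module Submission where

-- Fix an edge metric generator S = {s₁,…,sₖ}.  Every edge e gets its
-- representation r(e) = (d(e,s₁),…,d(e,sₖ)), a word over {0,…,D} that
-- determines e.  Since d(e,s) = 0 exactly when s is an endpoint of e, the
-- word r(e) has as many zeros as e has endpoints in S.
--   * Edges with both endpoints in S are determined by the positions of the
--     two zeros of r(e); truncating r(e) at 1 gives a 0/1 word with two zeros.
--   * Every other edge has a word r(e) with at most one zero.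

open import Defs
open import Data.Nat using (ℕ; _≤_; _+_; _*_; _^_; _∸_)
open import Data.Nat.Combinatorics using (_C_)

open import Data.Nat.Base using (zero; suc; z≤n; s≤s; _⊓_)
import Data.Nat.Properties as ℕ
open import Data.Nat.Combinatorics using (k>n⇒nCk≡0; nCk+nC[k+1]≡[n+1]C[k+1]; nC1≡n)
open import Algebra.Properties.CommutativeSemigroup ℕ.*-commutativeSemigroup using (x∙yz≈y∙xz)
open import Data.Fin.Base using (Fin; zero; suc) renaming (_<_ to _<ᶠ_)
import Data.Fin.Properties as FinP
open import Data.Fin.Subset using (Subset; ∣_∣) renaming (_∈_ to _∈ₛ_)
open import Data.Vec.Base using ([]; _∷_; here; there)
open import Data.Bool.Base using (true; false; T)
open import Data.Bool.Properties using (T?)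
open import Data.List.Base using (List; []; _∷_; length; map; _++_; filter; applyUpTo; cartesianProductWith; cartesianProduct; allFin)
open import Data.List.Properties using (length-map; length-++; length-++-sucʳ; length-applyUpTo)
open import Data.List.Membership.Propositional using (_∈_)
open import Data.List.Membership.Propositional.Properties using (∈-map⁺; ∈-++⁺ˡ; ∈-++⁺ʳ; ∈-∃++; ∈-filter⁺; ∈-filter⁻; ∈-cartesianProductWith⁺; ∈-applyUpTo⁺)
open import Data.List.Relation.Binary.Subset.Propositional using (_⊆_)
open import Data.List.Relation.Unary.Any using (here; there)
open import Data.List.Relation.Unary.All as All using (All; []; _∷_)
import Data.List.Relation.Unary.All.Properties as AllP
open import Data.List.Relation.Unary.AllPairs using ([]; _∷_)
open import Data.List.Relation.Unary.Unique.Propositional using (Unique)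
import Data.List.Relation.Unary.Unique.Propositional.Properties as UniqueP
open import Data.Product.Base using (∃-syntax; _×_; _,_; proj₁; proj₂)
open import Data.Product.Properties using (≡-dec)
open import Data.Sum.Base using (_⊎_; inj₁; inj₂)
open import Data.Empty using (⊥-elim)
open import Function.Base using (case_of_)
open import Relation.Nullary using (¬_; Dec; yes; no; _×-dec_)
open import Relation.Unary using (Decidable)
open import Relation.Unary.Properties using (∁?)
import Relation.Binary.PropositionalEquality as ≡
open import Relation.Binary.PropositionalEquality using (_≡_; _≢_; refl; trans; cong; cong₂; subst; subst₂; module ≡-Reasoning)

-- Counting duplicate-free lists by injections.

∈-remove : ∀ {A : Set} (as : List A) {bs x z} → z ∈ as ++ x ∷ bs → z ≢ x → z ∈ as ++ bs
∈-remove []       (here refl) z≢x = ⊥-elim (z≢x refl)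
∈-remove []       (there z∈)  _   = z∈
∈-remove (a ∷ as) (here refl) _   = here refl
∈-remove (a ∷ as) (there z∈)  z≢x = there (∈-remove as z∈ z≢x)

module _ {A : Set} where

  injection-length : ∀ {B : Set} {xs : List A} {ys : List B} (f : A → B) → Unique xs →
    (∀ {a} → a ∈ xs → f a ∈ ys) →
    (∀ {a b} → a ∈ xs → b ∈ xs → f a ≡ f b → a ≡ b) →
    length xs ≤ length ys
  injection-length f [] _ _ = z≤n
  injection-length {xs = x ∷ xs} f (x∉xs ∷ uniq) into inj with ∈-∃++ (into (here refl))
  ... | as , bs , refl = begin
    suc (length xs)          ≤⟨ s≤s (injection-length f uniq into′ inj′) ⟩
    suc (length (as ++ bs))  ≡⟨ length-++-sucʳ as (f x) bs ⟨
    length (as ++ f x ∷ bs)  ∎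
    where
    open ℕ.≤-Reasoning
    inj′ : ∀ {a b} → a ∈ xs → b ∈ xs → f a ≡ f b → a ≡ b
    inj′ a∈ b∈ = inj (there a∈) (there b∈)
    -- f x is hit only by x, so the other elements land in the rest of the list.
    into′ : ∀ {a} → a ∈ xs → f a ∈ as ++ bs
    into′ a∈ = ∈-remove as (into (there a∈))
                 (λ fa≡fx → All.lookup x∉xs a∈ (≡.sym (inj (there a∈) (here refl) fa≡fx)))

  ⊆-length : ∀ {xs ys : List A} → Unique xs → xs ⊆ ys → length xs ≤ length ys
  ⊆-length uniq xs⊆ys = injection-length (λ a → a) uniq xs⊆ys (λ _ _ a≡b → a≡b)

  length-filter-∁ : ∀ {P : A → Set} (P? : Decidable P) xs →
    length xs ≡ length (filter P? xs) + length (filter (∁? P?) xs)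
  length-filter-∁ P? [] = refl
  length-filter-∁ P? (x ∷ xs) with P? x
  ... | yes _ = cong suc (length-filter-∁ P? xs)
  ... | no  _ = trans (cong suc (length-filter-∁ P? xs)) (≡.sym (ℕ.+-suc _ _))

  map-≡-at : ∀ {B : Set} (f g : A → B) {xs s} → map f xs ≡ map g xs → s ∈ xs → f s ≡ g s
  map-≡-at f g {x ∷ xs} eq (here refl) = cong (λ { (b ∷ _) → b ; [] → f x }) eq
  map-≡-at f g {x ∷ xs} eq (there s∈) = map-≡-at f g (cong (λ { (_ ∷ bs) → bs ; [] → [] }) eq) s∈

length-cartesianProductWith : ∀ {A B C : Set} (f : A → B → C) xs ys →
  length (cartesianProductWith f xs ys) ≡ length xs * length ys
length-cartesianProductWith f []       ys = refl
length-cartesianProductWith f (x ∷ xs) ys = trans (length-++ (map (f x) ys))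
  (cong₂ _+_ (length-map (f x) ys) (length-cartesianProductWith f xs ys))

-- Words over {0, …, D} with a prescribed number of zeros.

zeros : List ℕ → ℕ
zeros []          = 0
zeros (zero ∷ w)  = suc (zeros w)
zeros (suc _ ∷ w) = zeros w

zeros-map : ∀ {X : Set} (f : X → ℕ) r → zeros (map f r) ≡ length (filter (λ s → f s ℕ.≟ 0) r)
zeros-map f [] = refl
zeros-map f (s ∷ r) with f s
... | zero  = cong suc (zeros-map f r)
... | suc _ = zeros-map f r

zeros-⊓1 : ∀ {X : Set} (f : X → ℕ) r → zeros (map (λ s → f s ⊓ 1) r) ≡ zeros (map f r)
zeros-⊓1 f [] = refl
zeros-⊓1 f (s ∷ r) with f s
... | zero  = cong suc (zeros-⊓1 f r)
... | suc _ = zeros-⊓1 f r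

module Words (D : ℕ) where

  positives : List ℕ
  positives = applyUpTo suc D

  withPositive : List (List ℕ) → List (List ℕ)
  withPositive ws = cartesianProductWith _∷_ positives ws

  length-withPositive : ∀ ws → length (withPositive ws) ≡ D * length ws
  length-withPositive ws = trans (length-cartesianProductWith _∷_ positives ws)
                                 (cong (_* length ws) (length-applyUpTo suc D))

  -- words j k enumerates the words of length k over {0, …, D} with exactly j
  -- zeros, split by whether the first letter is 0.
  words : ℕ → ℕ → List (List ℕ)
  words zero    zero    = [] ∷ []
  words (suc j) zero    = []
  words zero    (suc k) = withPositive (words zero k)
  words (suc j) (suc k) = map (0 ∷_) (words j k) ++ withPositive (words (suc j) k)

  -- The factor D^(k ∸ i) absorbs one more letter, unless the binomial factor vanishes.
  absorb : ∀ k i → D * ((k C suc i) * D ^ (k ∸ suc i)) ≡ (k C suc i) * D ^ (k ∸ i)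
  absorb k i with suc i ℕ.≤? k
  ... | yes i<k = begin
    D * ((k C suc i) * D ^ (k ∸ suc i))  ≡⟨ x∙yz≈y∙xz D (k C suc i) _ ⟩
    (k C suc i) * D ^ suc (k ∸ suc i)    ≡⟨ cong (λ m → (k C suc i) * D ^ m) (ℕ.+-∸-assoc 1 i<k) ⟨
    (k C suc i) * D ^ (k ∸ i)            ∎
    where open ≡-Reasoning
  ... | no  i≮k rewrite k>n⇒nCk≡0 (ℕ.≰⇒> i≮k) = ℕ.*-zeroʳ D

  length-words : ∀ j k → length (words j k) ≡ (k C j) * D ^ (k ∸ j)
  length-words zero    zero    = refl
  length-words (suc j) zero    = refl
  length-words zero    (suc k) = begin
    length (withPositive (words zero k))  ≡⟨ length-withPositive (words zero k) ⟩
    D * length (words zero k)             ≡⟨ cong (D *_) (length-words zero k) ⟩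
    D * (1 * D ^ k)                       ≡⟨ cong (D *_) (ℕ.*-identityˡ (D ^ k)) ⟩
    D ^ suc k                             ≡⟨ ℕ.*-identityˡ (D ^ suc k) ⟨
    1 * D ^ suc k                         ∎
    where open ≡-Reasoning
  length-words (suc j) (suc k) = begin
    length (map (0 ∷_) (words j k) ++ withPositive (words (suc j) k))
      ≡⟨ length-++ (map (0 ∷_) (words j k)) ⟩
    length (map (0 ∷_) (words j k)) + length (withPositive (words (suc j) k))
      ≡⟨ cong₂ _+_ (trans (length-map (0 ∷_) (words j k)) (length-words j k))
                   (trans (length-withPositive (words (suc j) k)) (cong (D *_) (length-words (suc j) k))) ⟩
    (k C j) * D ^ (k ∸ j) + D * ((k C suc j) * D ^ (k ∸ suc j))
      ≡⟨ cong ((k C j) * D ^ (k ∸ j) +_) (absorb k j) ⟩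
    (k C j) * D ^ (k ∸ j) + (k C suc j) * D ^ (k ∸ j)
      ≡⟨ ℕ.*-distribʳ-+ (D ^ (k ∸ j)) (k C j) (k C suc j) ⟨
    (k C j + k C suc j) * D ^ (k ∸ j)
      ≡⟨ cong (_* D ^ (k ∸ j)) (nCk+nC[k+1]≡[n+1]C[k+1] k j) ⟩
    (suc k C suc j) * D ^ (k ∸ j)
      ∎
    where open ≡-Reasoning

  ∈-words-withPositive : ∀ j {k a w} → a ∈ positives → w ∈ words j k → (a ∷ w) ∈ words j (suc k)
  ∈-words-withPositive zero        a∈ w∈ = ∈-cartesianProductWith⁺ _∷_ a∈ w∈
  ∈-words-withPositive (suc j) {k} a∈ w∈ =
    ∈-++⁺ʳ (map (0 ∷_) (words j k)) (∈-cartesianProductWith⁺ _∷_ a∈ w∈)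

  ∈-words : ∀ {w} → All (_≤ D) w → w ∈ words (zeros w) (length w)
  ∈-words [] = here refl
  ∈-words {zero ∷ w}  (_   ∷ w≤D) = ∈-++⁺ˡ (∈-map⁺ (0 ∷_) (∈-words w≤D))
  ∈-words {suc a ∷ w} (a<D ∷ w≤D) =
    ∈-words-withPositive (zeros w) (∈-applyUpTo⁺ suc a<D) (∈-words w≤D)

  ∈-words-≤1 : ∀ {w} → All (_≤ D) w → zeros w ≤ 1 → w ∈ words 1 (length w) ++ words 0 (length w)
  ∈-words-≤1 {w} w≤D z≤1 with zeros w | ∈-words w≤D
  ... | 0 | w∈ = ∈-++⁺ʳ (words 1 (length w)) w∈
  ... | 1 | w∈ = ∈-++⁺ˡ w∈
  ... | suc (suc _) | _ with z≤1
  ...   | s≤s ()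

members : ∀ {n} → Subset n → List (Fin n)
members []          = []
members (true ∷ S)  = zero ∷ map suc (members S)
members (false ∷ S) = map suc (members S)

length-members : ∀ {n} (S : Subset n) → length (members S) ≡ ∣ S ∣
length-members []          = refl
length-members (true ∷ S)  = cong suc (trans (length-map suc (members S)) (length-members S))
length-members (false ∷ S) = trans (length-map suc (members S)) (length-members S)

∈-members : ∀ {n} {S : Subset n} {s} → s ∈ₛ S → s ∈ members S
∈-members {S = true ∷ S}  here      = here refl
∈-members {S = true ∷ S}  (there p) = there (∈-map⁺ suc (∈-members p))
∈-members {S = false ∷ S} (there p) = ∈-map⁺ suc (∈-members p)

members-unique : ∀ {n} (S : Subset n) → Unique (members S)
members-unique []          = []
members-unique (true ∷ S)  =
  AllP.map⁺ (All.universal (λ _ ()) (members S)) ∷ UniqueP.map⁺ FinP.suc-injective (members-unique S)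
members-unique (false ∷ S) = UniqueP.map⁺ FinP.suc-injective (members-unique S)

-- Distances in a connected graph, as functions.

least-or-none : ∀ {P : ℕ → Set} → Decidable P → ∀ m →
  (∀ j → j ≤ m → ¬ P j) ⊎ (∃[ k ] P k × (∀ j → P j → k ≤ j))
least-or-none P? zero with P? 0
... | yes p0  = inj₂ (0 , p0 , λ _ _ → z≤n)
... | no  ¬p0 = inj₁ λ { .0 z≤n → ¬p0 }
least-or-none P? (suc m) with least-or-none P? m
... | inj₂ least = inj₂ least
... | inj₁ none with P? (suc m)
...   | yes pm = inj₂ (suc m , pm , λ j pj → ℕ.≰⇒> (λ j≤m → none j j≤m pj))
...   | no ¬pm = inj₁ λ j j≤1+m pj → case ℕ.m≤n⇒m<n∨m≡n j≤1+m of λ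
          { (inj₁ (s≤s j≤m)) → none j j≤m pj
          ; (inj₂ refl)      → ¬pm pj }

least : ∀ {P : ℕ → Set} → Decidable P → ∀ {m} → P m → ∃[ k ] P k × (∀ j → P j → k ≤ j)
least P? {m} pm with least-or-none P? m
... | inj₁ none  = ⊥-elim (none m ℕ.≤-refl pm)
... | inj₂ found = found

module Distance {n : ℕ} (G : Graph n) (connected : Connected G) where

  walk? : ∀ ℓ x y → Dec (Walk G x y ℓ)
  walk? zero x y with x FinP.≟ y
  ... | yes refl = yes here
  ... | no  x≢y  = no λ { here → x≢y refl }
  walk? (suc ℓ) x y with FinP.any? (λ z → T? (adj G x z) ×-dec walk? ℓ z y)
  ... | yes (z , xz , w) = yes (step xz w)
  ... | no  ¬w = no λ { (step {y = z} xz w) → ¬w (z , xz , w) }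

  dist-exists : ∀ x y → ∃[ m ] Dist G x y m
  dist-exists x y = least (λ ℓ → walk? ℓ x y) (proj₂ (connected x y))

  dist : Fin n → Fin n → ℕ
  dist x y = proj₁ (dist-exists x y)

  dist-spec : ∀ x y → Dist G x y (dist x y)
  dist-spec x y = proj₂ (dist-exists x y)

  Dist-unique : ∀ {x y a b} → Dist G x y a → Dist G x y b → a ≡ b
  Dist-unique (wa , a-min) (wb , b-min) = ℕ.≤-antisym (a-min _ wb) (b-min _ wa)

  dist-self : ∀ x → dist x x ≡ 0
  dist-self x = Dist-unique (dist-spec x x) (here , λ _ _ → z≤n)

  dist≡0 : ∀ {x y} → dist x y ≡ 0 → x ≡ y
  dist≡0 {x} {y} d≡0 with subst (Walk G x y) d≡0 (proj₁ (dist-spec x y))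
  ... | here = refl

  edist : Fin n × Fin n → Fin n → ℕ
  edist (x , y) v = dist x v ⊓ dist y v

  EDist-unique : ∀ e v {a} → EDist G e v a → a ≡ edist e v
  EDist-unique (x , y) v (_ , _ , dx , dy , refl) =
    cong₂ _⊓_ (Dist-unique dx (dist-spec x v)) (Dist-unique dy (dist-spec y v))

  edist-endpoint₁ : ∀ x y → edist (x , y) x ≡ 0
  edist-endpoint₁ x y rewrite dist-self x = refl

  edist-endpoint₂ : ∀ x y → edist (x , y) y ≡ 0
  edist-endpoint₂ x y rewrite dist-self y = ℕ.⊓-zeroʳ (dist x y)

  edist≡0 : ∀ x y v → edist (x , y) v ≡ 0 → v ≡ x ⊎ v ≡ y
  edist≡0 x y v e≡0 with ℕ.⊓-sel (dist x v) (dist y v)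
  ... | inj₁ min≡dx = inj₁ (≡.sym (dist≡0 (trans (≡.sym min≡dx) e≡0)))
  ... | inj₂ min≡dy = inj₂ (≡.sym (dist≡0 (trans (≡.sym min≡dy) e≡0)))

-- Counting the edges against an edge metric generator.

IsEdge : ∀ {n} → Graph n → Fin n × Fin n → Set
IsEdge G (x , y) = x <ᶠ y × T (adj G x y)

ordered-pair-≡ : ∀ {n} {x y x′ y′ : Fin n} → x <ᶠ y → x′ <ᶠ y′ →
  x ≡ x′ ⊎ x ≡ y′ → y ≡ x′ ⊎ y ≡ y′ → (x , y) ≡ (x′ , y′)
ordered-pair-≡ x<y _     (inj₁ x≡x′) (inj₂ y≡y′) = cong₂ _,_ x≡x′ y≡y′
ordered-pair-≡ x<y _     (inj₁ x≡x′) (inj₁ y≡x′) =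
  ⊥-elim (FinP.<⇒≢ x<y (trans x≡x′ (≡.sym y≡x′)))
ordered-pair-≡ x<y _     (inj₂ x≡y′) (inj₂ y≡y′) =
  ⊥-elim (FinP.<⇒≢ x<y (trans x≡y′ (≡.sym y≡y′)))
ordered-pair-≡ x<y x′<y′ (inj₂ x≡y′) (inj₁ y≡x′) =
  ⊥-elim (FinP.<-asym x′<y′ (subst₂ _<ᶠ_ x≡y′ y≡x′ x<y))

⊓1≡0 : ∀ a → a ⊓ 1 ≡ 0 → a ≡ 0
⊓1≡0 zero    _ = refl
⊓1≡0 (suc a) ()

module EdgeCount {n : ℕ} (G : Graph n) (connected : Connected G)
                 (D : ℕ) (dist≤D : ∀ u v m → Dist G u v m → m ≤ D)
                 (S : Subset n) (generator : IsEdgeMetricGenerator G S) where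
  open Distance G connected
  open Words D using (words; length-words; ∈-words-≤1)
  open import Data.List.Membership.DecPropositional (FinP._≟_ {n}) using (_∈?_)

  ks : List (Fin n)
  ks = members S

  k : ℕ
  k = length ks

  rep : Fin n × Fin n → List ℕ
  rep e = map (edist e) ks

  rep-bounded : ∀ e → All (_≤ D) (rep e)
  rep-bounded (x , y) = AllP.map⁺ (All.universal
    (λ v → ℕ.≤-trans (ℕ.m⊓n≤m _ _) (dist≤D x v _ (dist-spec x v))) ks)

  rep-injective : ∀ {e f} → IsEdge G e → IsEdge G f → rep e ≡ rep f → e ≡ f
  rep-injective {e} {f} edge-e edge-f r≡r with ≡-dec FinP._≟_ FinP._≟_ e f
  ... | yes e≡f = e≡f
  ... | no  e≢f with generator (e , edge-e) (f , edge-f) e≢f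
  ...   | s , s∈S , a , b , da , db , a≢b = ⊥-elim (a≢b (begin
    a          ≡⟨ EDist-unique e s da ⟩
    edist e s  ≡⟨ map-≡-at (edist e) (edist f) r≡r (∈-members s∈S) ⟩
    edist f s  ≡⟨ EDist-unique f s db ⟨
    b          ∎))
    where open ≡-Reasoning

  hits : Fin n × Fin n → List (Fin n)
  hits e = filter (λ s → edist e s ℕ.≟ 0) ks

  hits-unique : ∀ e → Unique (hits e)
  hits-unique e = UniqueP.filter⁺ (λ s → edist e s ℕ.≟ 0) (members-unique S)

  hits⊆endpoints : ∀ {x y s} → s ∈ hits (x , y) → s ≡ x ⊎ s ≡ y
  hits⊆endpoints {x} {y} {s} s∈ =
    edist≡0 x y s (proj₂ (∈-filter⁻ (λ s → edist (x , y) s ℕ.≟ 0) {xs = ks} s∈))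

  hits⊆S : ∀ {e s} → s ∈ hits e → s ∈ ks
  hits⊆S {e} s∈ = proj₁ (∈-filter⁻ (λ s → edist e s ℕ.≟ 0) {xs = ks} s∈)

  endpoint∈hits : ∀ {e s} → s ∈ ks → edist e s ≡ 0 → s ∈ hits e
  endpoint∈hits {e} = ∈-filter⁺ (λ s → edist e s ℕ.≟ 0)

  zeros-rep : ∀ e → zeros (rep e) ≡ length (hits e)
  zeros-rep e = zeros-map (edist e) ks

  BothInS : Fin n × Fin n → Set
  BothInS (x , y) = x ∈ ks × y ∈ ks

  bothInS? : Decidable BothInS
  bothInS? (x , y) = (x ∈? ks) ×-dec (y ∈? ks)

  zeros-rep-BothInS : ∀ {e} → IsEdge G e → BothInS e → zeros (rep e) ≡ 2
  zeros-rep-BothInS {x , y} (x<y , _) (x∈ , y∈) =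
    trans (zeros-rep (x , y)) (ℕ.≤-antisym (⊆-length (hits-unique (x , y)) hits⊆xy)
                                            (⊆-length xy-unique xy⊆hits))
    where
    hits⊆xy : hits (x , y) ⊆ x ∷ y ∷ []
    hits⊆xy s∈ with hits⊆endpoints s∈
    ... | inj₁ s≡x = here s≡x
    ... | inj₂ s≡y = there (here s≡y)
    xy-unique : Unique (x ∷ y ∷ [])
    xy-unique = (FinP.<⇒≢ x<y ∷ []) ∷ [] ∷ []
    xy⊆hits : x ∷ y ∷ [] ⊆ hits (x , y)
    xy⊆hits (here refl)         = endpoint∈hits x∈ (edist-endpoint₁ x y)
    xy⊆hits (there (here refl)) = endpoint∈hits y∈ (edist-endpoint₂ x y)

  zeros-rep-≤1 : ∀ e z → (∀ {s} → s ∈ hits e → s ≡ z) → zeros (rep e) ≤ 1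
  zeros-rep-≤1 e z only-z = ℕ.≤-trans (ℕ.≤-reflexive (zeros-rep e))
                                       (⊆-length {ys = z ∷ []} (hits-unique e) (λ s∈ → here (only-z s∈)))

  zeros-rep-¬BothInS : ∀ {e} → ¬ BothInS e → zeros (rep e) ≤ 1
  zeros-rep-¬BothInS {x , y} ¬both with x ∈? ks
  ... | yes x∈ = zeros-rep-≤1 (x , y) x λ s∈ → case hits⊆endpoints s∈ of λ
          { (inj₁ s≡x) → s≡x
          ; (inj₂ refl) → ⊥-elim (¬both (x∈ , hits⊆S {x , y} s∈)) }
  ... | no  x∉ = zeros-rep-≤1 (x , y) y λ s∈ → case hits⊆endpoints s∈ of λ
          { (inj₁ refl) → ⊥-elim (x∉ (hits⊆S {x , y} s∈))
          ; (inj₂ s≡y) → s≡y }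

  zeroPattern : Fin n × Fin n → List ℕ
  zeroPattern e = map (λ s → edist e s ⊓ 1) ks

  zeroPattern-bounded : ∀ e → All (_≤ 1) (zeroPattern e)
  zeroPattern-bounded e = AllP.map⁺ (All.universal (λ s → ℕ.m⊓n≤n (edist e s) 1) ks)

  zeroPattern-injective : ∀ {e f} → IsEdge G e → IsEdge G f → BothInS e →
    zeroPattern e ≡ zeroPattern f → e ≡ f
  zeroPattern-injective {x , y} {x′ , y′} (x<y , _) (x′<y′ , _) (x∈ , y∈) p≡p =
    ordered-pair-≡ x<y x′<y′ (endpoint-of-f x∈ (edist-endpoint₁ x y))
                             (endpoint-of-f y∈ (edist-endpoint₂ x y))
    where
    endpoint-of-f : ∀ {s} → s ∈ ks → edist (x , y) s ≡ 0 → s ≡ x′ ⊎ s ≡ y′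
    endpoint-of-f {s} s∈ e≡0 = edist≡0 x′ y′ s (⊓1≡0 _ (begin
      edist (x′ , y′) s ⊓ 1  ≡⟨ map-≡-at (λ t → edist (x , y) t ⊓ 1) (λ t → edist (x′ , y′) t ⊓ 1)
                                          p≡p s∈ ⟨
      edist (x , y) s ⊓ 1    ≡⟨ cong (_⊓ 1) e≡0 ⟩
      0                      ∎))
      where open ≡-Reasoning

  class-bound : ∀ {Q : Fin n × Fin n → Set} (Q? : Decidable Q) {L : List (Fin n × Fin n)} →
    Unique L → (∀ {e} → e ∈ L → IsEdge G e) →
    (code : Fin n × Fin n → List ℕ) (M : List (List ℕ)) →
    (∀ {e} → IsEdge G e → Q e → code e ∈ M) →
    (∀ {e f} → IsEdge G e → IsEdge G f → Q e → Q f → code e ≡ code f → e ≡ f) →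
    length (filter Q? L) ≤ length M
  class-bound {Q} Q? {L} uniq edges code M into inj =
    injection-length code (UniqueP.filter⁺ Q? uniq)
      (λ e∈ → into (edge e∈) (class e∈))
      (λ e∈ f∈ → inj (edge e∈) (edge f∈) (class e∈) (class f∈))
    where
    edge : ∀ {e} → e ∈ filter Q? L → IsEdge G e
    edge e∈ = edges (proj₁ (∈-filter⁻ Q? {xs = L} e∈))
    class : ∀ {e} → e ∈ filter Q? L → Q e
    class e∈ = proj₂ (∈-filter⁻ Q? {xs = L} e∈)

  bound-BothInS : ∀ {L} → Unique L → (∀ {e} → e ∈ L → IsEdge G e) →
    length (filter bothInS? L) ≤ k C 2
  bound-BothInS {L} uniq edges = begin
    length (filter bothInS? L)  ≤⟨ class-bound bothInS? uniq edges zeroPattern (Words.words 1 2 k) into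
                                       (λ edge-e edge-f both _ → zeroPattern-injective edge-e edge-f both) ⟩
    length (Words.words 1 2 k)  ≡⟨ Words.length-words 1 2 k ⟩
    (k C 2) * 1 ^ (k ∸ 2)       ≡⟨ cong ((k C 2) *_) (ℕ.^-zeroˡ (k ∸ 2)) ⟩
    (k C 2) * 1                 ≡⟨ ℕ.*-identityʳ (k C 2) ⟩
    k C 2                       ∎
    where
    open ℕ.≤-Reasoning
    into : ∀ {e} → IsEdge G e → BothInS e → zeroPattern e ∈ Words.words 1 2 k
    into {e} edge-e both = subst₂ (λ j m → zeroPattern e ∈ Words.words 1 j m)
      (trans (zeros-⊓1 (edist e) ks) (zeros-rep-BothInS edge-e both))
      (length-map _ ks)
      (Words.∈-words 1 (zeroPattern-bounded e))

  bound-¬BothInS : ∀ {L} → Unique L → (∀ {e} → e ∈ L → IsEdge G e) →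
    length (filter (∁? bothInS?) L) ≤ k * D ^ (k ∸ 1) + D ^ k
  bound-¬BothInS {L} uniq edges = begin
    length (filter (∁? bothInS?) L)
      ≤⟨ class-bound (∁? bothInS?) uniq edges rep (words 1 k ++ words 0 k) into
                     (λ edge-e edge-f _ _ → rep-injective edge-e edge-f) ⟩
    length (words 1 k ++ words 0 k)         ≡⟨ length-++ (words 1 k) ⟩
    length (words 1 k) + length (words 0 k) ≡⟨ cong₂ _+_ (length-words 1 k) (length-words 0 k) ⟩
    (k C 1) * D ^ (k ∸ 1) + 1 * D ^ k
      ≡⟨ cong₂ _+_ (cong (_* D ^ (k ∸ 1)) (nC1≡n k)) (ℕ.*-identityˡ (D ^ k)) ⟩
    k * D ^ (k ∸ 1) + D ^ k                 ∎
    where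
    open ℕ.≤-Reasoning
    into : ∀ {e} → IsEdge G e → ¬ BothInS e → rep e ∈ words 1 k ++ words 0 k
    into {e} _ ¬both = subst (λ m → rep e ∈ words 1 m ++ words 0 m) (length-map (edist e) ks)
      (∈-words-≤1 (rep-bounded e) (zeros-rep-¬BothInS ¬both))

  edges-bound : ∀ {L} → Unique L → (∀ {e} → e ∈ L → IsEdge G e) →
    length L ≤ (k C 2) + k * D ^ (k ∸ 1) + D ^ k
  edges-bound {L} uniq edges = begin
    length L
      ≡⟨ length-filter-∁ bothInS? L ⟩
    length (filter bothInS? L) + length (filter (∁? bothInS?) L)
      ≤⟨ ℕ.+-mono-≤ (bound-BothInS uniq edges) (bound-¬BothInS uniq edges) ⟩
    (k C 2) + (k * D ^ (k ∸ 1) + D ^ k)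
      ≡⟨ ℕ.+-assoc (k C 2) _ _ ⟨
    (k C 2) + k * D ^ (k ∸ 1) + D ^ k
      ∎
    where open ℕ.≤-Reasoning

theorem3p4 : ∀ (n : ℕ) (G : Graph n) → Connected G → ∀ (D k : ℕ) →
    IsDiameter G D → IsEdim G k →
    numEdges G ≤ (k C 2) + k * D ^ (k ∸ 1) + D ^ k
theorem3p4 n G connected D k (_ , dist≤D) ((S , generator , ∣S∣≡k) , _) =
  subst (λ m → numEdges G ≤ (m C 2) + m * D ^ (m ∸ 1) + D ^ m) (trans (length-members S) ∣S∣≡k)
    (EdgeCount.edges-bound G connected D dist≤D S generator
      (UniqueP.filter⁺ _ (UniqueP.cartesianProduct⁺ (UniqueP.allFin⁺ n) (UniqueP.allFin⁺ n)))
      (λ e∈ → proj₂ (∈-filter⁻ _ {xs = cartesianProduct (allFin n) (allFin n)} e∈)))
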